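{- Let $G$ and $H$ be nontrivial, connected graphs. If $G\times H$ is well-covered but not very well-covered, then both $G$ and $H$ have girth $3$.
   Context: All graphs are finite and simple; nontrivial means having at least two vertices. The direct product $G\times H$ has vertex set $V(G)\times V(H)$, with $(g_1,h_1)(g_2,h_2)$ an edge iff $g_1g_2\in E(G)$ and $h_1h_2\in E(H)$. A graph is well-covered if all of its maximal independent sets have the same cardinality. A graph is very well-covered if it is well-covered, has no isolated vertices, and its independence number equals half its order. -}

module Defs where

open import Data.Nat using (ℕ; zero; suc; _*_; _≤_)
open import Data.Fin using (Fin; zero; suc; inject₁; fromℕ; remQuot)
open import Data.Fin.Subset using (Subset; _∈_; _⊆_; ∣_∣)
open import Data.Empty using (⊥)
open import Data.Product using (Σ; ∃; _×_; _,_; proj₁; proj₂)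
open import Relation.Nullary using (¬_; Dec)
open import Relation.Nullary.Decidable using (_×-dec_)
open import Relation.Binary.PropositionalEquality using (_≡_)
open import Function.Definitions using (Injective)

record Graph : Set₁ where
  field
    n      : ℕ
    Adj    : Fin n → Fin n → Set
    adj?   : ∀ u v → Dec (Adj u v)
    sym    : ∀ {u v} → Adj u v → Adj v u
    irrefl : ∀ {u} → ¬ Adj u u

open Graph public

-- Direct (tensor / categorical) product; vertex (g , h) is encoded via remQuot.
_×ᵍ_ : Graph → Graph → Graph
G ×ᵍ H = record
  { n      = n G * n H
  ; Adj    = A
  ; adj?   = λ u v → adj? G (proj₁ (rq u)) (proj₁ (rq v)) ×-dec adj? H (proj₂ (rq u)) (proj₂ (rq v))
  ; sym    = λ (p , q) → sym G p , sym H q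
  ; irrefl = λ (p , q) → irrefl G p
  }
  where
    rq : Fin (n G * n H) → Fin (n G) × Fin (n H)
    rq = remQuot (n H)
    A : Fin (n G * n H) → Fin (n G * n H) → Set
    A u v = Adj G (proj₁ (rq u)) (proj₁ (rq v)) × Adj H (proj₂ (rq u)) (proj₂ (rq v))

Nontrivial : Graph → Set
Nontrivial G = 2 ≤ n G

data Walk (G : Graph) : Fin (n G) → Fin (n G) → Set where
  here  : ∀ {u} → Walk G u u
  step  : ∀ {u v w} → Adj G u v → Walk G v w → Walk G u w

Connected : Graph → Set
Connected G = ∀ u v → Walk G u v

Independent : (G : Graph) → Subset (n G) → Set
Independent G S = ∀ u v → u ∈ S → v ∈ S → ¬ Adj G u v

MaximalIndependent : (G : Graph) → Subset (n G) → Set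
MaximalIndependent G S =
  Independent G S × (∀ T → S ⊆ T → Independent G T → T ⊆ S)

WellCovered : Graph → Set
WellCovered G = ∀ S T → MaximalIndependent G S → MaximalIndependent G T → ∣ S ∣ ≡ ∣ T ∣

IsIndependenceNumber : Graph → ℕ → Set
IsIndependenceNumber G k =
  (Σ (Subset (n G)) λ S → Independent G S × ∣ S ∣ ≡ k) ×
  (∀ S → Independent G S → ∣ S ∣ ≤ k)

NoIsolatedVertices : Graph → Set
NoIsolatedVertices G = ∀ u → Σ (Fin (n G)) λ v → Adj G u v

VeryWellCovered : Graph → Set
VeryWellCovered G =
  WellCovered G × NoIsolatedVertices G ×
  (Σ ℕ λ k → IsIndependenceNumber G k × 2 * k ≡ n G)

-- A cycle of length suc m (m ≥ 2): an injective closed walk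
-- f 0 ~ f 1 ~ ... ~ f m ~ f 0.
Cycle : (G : Graph) → ℕ → Set
Cycle G zero    = ⊥
Cycle G (suc m) =
  2 ≤ m ×
  (Σ (Fin (suc m) → Fin (n G)) λ f →
     Injective _≡_ _≡_ f ×
     (∀ (i : Fin m) → Adj G (f (inject₁ i)) (f (suc i))) ×
     Adj G (f (fromℕ m)) (f zero))

HasGirth : Graph → ℕ → Set
HasGirth G g = Cycle G g × (∀ k → Cycle G k → g ≤ k)

module Submission where

-- Let P be triangle-free with an edge uv, let Q have no isolated vertices and let P × Q be
-- well-covered.  Take K maximal independent among the vertices of P outside N[u] ∪ N[v], and let
-- Rᵤ (resp. Rᵥ) be u (resp. v) together with the neighbours of v (resp. u) having no neighbour in
-- K.  Triangle-freeness makes K ∪ Rᵤ and K ∪ Rᵥ maximal independent in P, so for any maximal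
-- independent set A of Q the sets (K ∪ Rᵤ) × V(Q), (K ∪ Rᵥ) × V(Q) and (K × V(Q)) ∪ ((Rᵤ ∪ Rᵥ) × A)
-- are maximal independent in P × Q.  Equating their sizes gives
-- |Rᵤ| |Q| = |Rᵥ| |Q| = (|Rᵤ| + |Rᵥ|) |A|, hence |Q| = 2 |A|, and then the maximal independent set
-- V(P) × A has half the vertices: P × Q is very well-covered.  So if G × H is well-covered but not
-- very well-covered, neither factor is triangle-free, and a triangle means girth 3.

open import Defs renaming (sym to adj-sym)
open import Data.Bool using (Bool; true; false; T; _∨_; _∧_)
open import Data.Bool.Properties using (T-∨; T-∧; T-≡; T?)
open import Data.Empty using (⊥-elim)
open import Data.Fin using (Fin; zero; suc; _↑ˡ_; _↑ʳ_; remQuot; combine; inject₁)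
open import Data.Fin.Properties using (_≟_; any?; remQuot-combine; splitAt-↑ʳ)
open import Data.Fin.Subset using (_∈_; _⊆_; ∣_∣)
open import Data.Fin.Subset.Properties using (p⊆q⇒∣p∣≤∣q∣)
open import Data.List using (List; []; _∷_; allFin)
import Data.List.Membership.Propositional as List
open import Data.List.Membership.Propositional.Properties using (∈-allFin)
import Data.List.Relation.Unary.Any as Any
open import Data.Nat using (ℕ; zero; suc; _+_; _*_; _<_; _≤_; z≤n; s≤s; >-nonZero)
open import Data.Nat.Properties
  using (+-*-semiring; +-identityʳ; *-identityˡ; +-assoc; *-assoc; *-comm; *-distribʳ-+;
         +-cancelˡ-≡; *-cancelˡ-≡; ≤-trans; ≤-reflexive; m≤m+n; m≤n+m)
open import Data.Nat.Tactic.RingSolver using (solve-∀)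
open import Data.Product using (∃; _×_; _,_; proj₁; proj₂; uncurry; swap; map₁)
open import Data.Sum using (_⊎_; inj₁; inj₂; [_,_]′)
open import Data.Unit using (tt)
open import Data.Vec using (tabulate; lookup)
open import Data.Vec.Properties using (lookup∘tabulate; []=⇒lookup; lookup⇒[]=)
open import Function using (_∘_; flip; Equivalence)
open import Relation.Nullary using (¬_; Dec; yes; no)
open import Relation.Nullary.Decidable using (_×-dec_; _⊎-dec_; ¬?; ⌊_⌋; toWitness; fromWitness)
open import Relation.Binary.PropositionalEquality

open import Algebra.Properties.Semiring.Sum +-*-semiring

open Equivalence using (to; from)

-- Counting vertex sets given by indicator functions

iverson : Bool → ℕ
iverson true  = 1
iverson false = 0

count : ∀ {m} → (Fin m → Bool) → ℕ
count {m} b = ∑[ i < m ] iverson (b i)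

∣tabulate∣≡count : ∀ {m} (b : Fin m → Bool) → ∣ tabulate b ∣ ≡ count b
∣tabulate∣≡count {zero}  b = refl
∣tabulate∣≡count {suc m} b with b zero
... | true  = cong suc (∣tabulate∣≡count (b ∘ suc))
... | false = ∣tabulate∣≡count (b ∘ suc)

empty full : ∀ {m} → Fin m → Bool
empty _ = false
full  _ = true

count-empty : ∀ m → count (empty {m}) ≡ 0
count-empty zero    = refl
count-empty (suc m) = count-empty m

count-full : ∀ m → count (full {m}) ≡ m
count-full zero    = refl
count-full (suc m) = cong suc (count-full m)

T⇒0<count : ∀ {m} (b : Fin m → Bool) {i} → T (b i) → 0 < count b
T⇒0<count b {zero} bi with b zero
... | true = s≤s z≤n
T⇒0<count b {suc i} bi = ≤-trans (T⇒0<count (b ∘ suc) bi) (m≤n+m _ (iverson (b zero)))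

iverson-∨ : ∀ x y → (T x → ¬ T y) → iverson (x ∨ y) ≡ iverson x + iverson y
iverson-∨ true  true  x⇒¬y = ⊥-elim (x⇒¬y _ _)
iverson-∨ true  false _    = refl
iverson-∨ false _     _    = refl

count-∨ : ∀ {m} (b c : Fin m → Bool) → (∀ {i} → T (b i) → ¬ T (c i)) →
          count (λ i → b i ∨ c i) ≡ count b + count c
count-∨ b c disjoint = trans (sum-cong-≗ (λ i → iverson-∨ (b i) (c i) disjoint))
                             (∑-distrib-+ (iverson ∘ b) (iverson ∘ c))

sum-↑ : ∀ k {m} (f : Fin (k + m) → ℕ) → sum f ≡ sum (f ∘ (_↑ˡ m)) + sum (f ∘ (k ↑ʳ_))
sum-↑ zero    f = refl
sum-↑ (suc k) f = trans (cong (f zero +_) (sum-↑ k (f ∘ suc))) (sym (+-assoc (f zero) _ _))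

sum-remQuot : ∀ m k (F : Fin m → Fin k → ℕ) →
              sum (uncurry F ∘ remQuot {m} k) ≡ ∑[ i < m ] ∑[ j < k ] F i j
sum-remQuot zero    k F = refl
sum-remQuot (suc m) k F = begin
  sum (uncurry F ∘ remQuot {suc m} k)
    ≡⟨ sum-↑ k (uncurry F ∘ remQuot {suc m} k) ⟩
  sum (uncurry F ∘ remQuot {suc m} k ∘ (_↑ˡ (m * k))) + sum (uncurry F ∘ remQuot {suc m} k ∘ (k ↑ʳ_))
    ≡⟨ cong₂ _+_ (sum-cong-≗ (cong (uncurry F) ∘ remQuot-combine {suc m} zero))
                 (sum-cong-≗ (cong (uncurry F) ∘ remQuot-↑ʳ)) ⟩
  ∑[ j < k ] F zero j + sum (uncurry (F ∘ suc) ∘ remQuot {m} k)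
    ≡⟨ cong (∑[ j < k ] F zero j +_) (sum-remQuot m k (F ∘ suc)) ⟩
  ∑[ i < suc m ] ∑[ j < k ] F i j ∎
  where
  open ≡-Reasoning
  remQuot-↑ʳ : ∀ j → remQuot {suc m} k (k ↑ʳ j) ≡ map₁ suc (remQuot {m} k j)
  remQuot-↑ʳ j rewrite splitAt-↑ʳ k (m * k) j = refl

-- Maximal independent sets

module _ (G : Graph) where

  private
    V = Fin (n G)

  Independentᵇ : (V → Bool) → Set
  Independentᵇ S = ∀ {x y} → T (S x) → T (S y) → ¬ Adj G x y

  Dominated : (V → Bool) → V → Set
  Dominated S x = ∃ λ y → T (S y) × Adj G x y

  dominated? : ∀ S x → Dec (Dominated S x)
  dominated? S x = any? λ y → T? (S y) ×-dec adj? G x y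

  record MaximalIndependentWithin (R M : V → Bool) : Set where
    field
      independent : Independentᵇ M
      within      : ∀ {x} → T (M x) → T (R x)
      dominating  : ∀ {x} → T (R x) → ¬ T (M x) → Dominated M x

  MaximalIndependentᵇ : (V → Bool) → Set
  MaximalIndependentᵇ = MaximalIndependentWithin full

  Dominated-mono : ∀ {S S′} → (∀ {y} → T (S y) → T (S′ y)) → ∀ {x} → Dominated S x → Dominated S′ x
  Dominated-mono S⊆S′ (y , y∈S , xy) = y , S⊆S′ y∈S , xy

  module Greedy (R : V → Bool) where

    Invariant : (V → Bool) → Set
    Invariant S = Independentᵇ S × (∀ {x} → T (S x) → T (R x))

    Settled : (V → Bool) → V → Set
    Settled S x = T (S x) ⊎ Dominated S x

    insert : V → (V → Bool) → V → Bool
    insert x S y = S y ∨ ⌊ y ≟ x ⌋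

    visit : (V → Bool) → V → V → Bool
    visit S x with R x | dominated? S x
    ... | true | no _ = insert x S
    ... | _    | _    = S

    visit-⊇ : ∀ S x {y} → T (S y) → T (visit S x y)
    visit-⊇ S x {y} y∈S with R x | dominated? S x
    ... | true  | no _  = from T-∨ (inj₁ y∈S)
    ... | true  | yes _ = y∈S
    ... | false | _     = y∈S

    visit-invariant : ∀ S x → Invariant S → Invariant (visit S x)
    visit-invariant S x (S-ind , S⊆R) with R x in Rx | dominated? S x
    ... | true  | no ¬dom = independent , within
      where
      cases : ∀ {y} → T (insert x S y) → T (S y) ⊎ y ≡ x
      cases y∈ with to T-∨ y∈
      ... | inj₁ y∈S = inj₁ y∈S
      ... | inj₂ y≡x = inj₂ (toWitness y≡x)
      independent : Independentᵇ (insert x S)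
      independent y∈ z∈ yz with cases y∈ | cases z∈
      ... | inj₁ y∈S  | inj₁ z∈S  = S-ind y∈S z∈S yz
      ... | inj₁ y∈S  | inj₂ refl = ¬dom (_ , y∈S , adj-sym G yz)
      ... | inj₂ refl | inj₁ z∈S  = ¬dom (_ , z∈S , yz)
      ... | inj₂ refl | inj₂ refl = irrefl G yz
      within : ∀ {y} → T (insert x S y) → T (R y)
      within y∈ with cases y∈
      ... | inj₁ y∈S  = S⊆R y∈S
      ... | inj₂ refl = subst T (sym Rx) tt
    ... | true  | yes _ = S-ind , S⊆R
    ... | false | _     = S-ind , S⊆R

    visit-settles : ∀ S x → T (R x) → Settled (visit S x) x
    visit-settles S x x∈R with R x | dominated? S x
    ... | true | no _   = inj₁ (from (T-∨ {S x}) (inj₂ (fromWitness {a? = x ≟ x} refl)))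
    ... | true | yes d  = inj₂ d

    Settled-mono : ∀ {S S′} → (∀ {y} → T (S y) → T (S′ y)) → ∀ {x} → Settled S x → Settled S′ x
    Settled-mono S⊆S′ (inj₁ x∈S) = inj₁ (S⊆S′ x∈S)
    Settled-mono S⊆S′ (inj₂ dom) = inj₂ (Dominated-mono S⊆S′ dom)

    run : List V → (V → Bool) → V → Bool
    run []       S = S
    run (x ∷ xs) S = run xs (visit S x)

    run-⊇ : ∀ xs S {y} → T (S y) → T (run xs S y)
    run-⊇ []       S y∈S = y∈S
    run-⊇ (x ∷ xs) S y∈S = run-⊇ xs (visit S x) (visit-⊇ S x y∈S)

    run-invariant : ∀ xs S → Invariant S → Invariant (run xs S)
    run-invariant []       S inv = inv
    run-invariant (x ∷ xs) S inv = run-invariant xs (visit S x) (visit-invariant S x inv)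

    run-settles : ∀ xs S {x} → x List.∈ xs → T (R x) → Settled (run xs S) x
    run-settles (x ∷ xs) S (Any.here refl) x∈R = Settled-mono (run-⊇ xs (visit S x)) (visit-settles S x x∈R)
    run-settles (_ ∷ xs) S (Any.there x∈xs) x∈R = run-settles xs _ x∈xs x∈R

  extendWithin : ∀ R S → Independentᵇ S → (∀ {x} → T (S x) → T (R x)) →
                 ∃ λ M → (∀ {x} → T (S x) → T (M x)) × MaximalIndependentWithin R M
  extendWithin R S S-ind S⊆R = M , run-⊇ (allFin _) S , record
    { independent = proj₁ inv
    ; within      = proj₂ inv
    ; dominating  = dominating
    }
    where
    open Greedy R
    M   = run (allFin _) S
    inv = run-invariant (allFin _) S (S-ind , S⊆R)
    dominating : ∀ {x} → T (R x) → ¬ T (M x) → Dominated M x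
    dominating x∈R x∉M with run-settles (allFin _) S (∈-allFin _) x∈R
    ... | inj₁ x∈M = ⊥-elim (x∉M x∈M)
    ... | inj₂ dom = dom

  maximalIndependentWithin-exists : ∀ R → ∃ (MaximalIndependentWithin R)
  maximalIndependentWithin-exists R with extendWithin R empty (λ ()) (λ ())
  ... | M , _ , M-max = M , M-max

∈-tabulate⁺ : ∀ {m} (b : Fin m → Bool) {x} → T (b x) → x ∈ tabulate b
∈-tabulate⁺ b {x} bx = lookup⇒[]= x (tabulate b) (trans (lookup∘tabulate b x) (to T-≡ bx))

∈-tabulate⁻ : ∀ {m} (b : Fin m → Bool) {x} → x ∈ tabulate b → T (b x)
∈-tabulate⁻ b {x} x∈ = from T-≡ (trans (sym (lookup∘tabulate b x)) ([]=⇒lookup x∈))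

module _ (G : Graph) where

  maximalIndependent-tabulate : ∀ {M} → MaximalIndependentᵇ G M → MaximalIndependent G (tabulate M)
  maximalIndependent-tabulate {M} M-max =
    (λ x y x∈ y∈ → independent (∈-tabulate⁻ M x∈) (∈-tabulate⁻ M y∈)) , maximal
    where
    open MaximalIndependentWithin M-max
    maximal : ∀ T′ → tabulate M ⊆ T′ → Independent G T′ → T′ ⊆ tabulate M
    maximal T′ M⊆T′ T′-ind {x} x∈T′ with T? (M x)
    ... | yes x∈M = ∈-tabulate⁺ M x∈M
    ... | no  x∉M with dominating tt x∉M
    ...   | y , y∈M , xy = ⊥-elim (T′-ind x y x∈T′ (M⊆T′ (∈-tabulate⁺ M y∈M)) xy)

  extend : ∀ S → Independent G S → ∃ λ M → MaximalIndependent G M × ∣ S ∣ ≤ ∣ M ∣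
  extend S S-ind with extendWithin G full (lookup S)
                        (λ x∈ y∈ → S-ind _ _ (lookup⇒[]= _ S (to T-≡ x∈)) (lookup⇒[]= _ S (to T-≡ y∈)))
                        (λ _ → tt)
  ... | M , S⊆M , M-max =
    tabulate M , maximalIndependent-tabulate M-max ,
    p⊆q⇒∣p∣≤∣q∣ {p = S} (λ x∈S → ∈-tabulate⁺ M (S⊆M (from T-≡ ([]=⇒lookup x∈S))))

  wellCovered⇒independenceNumber : WellCovered G → ∀ {M} → MaximalIndependent G M → IsIndependenceNumber G ∣ M ∣
  wellCovered⇒independenceNumber wc {M} M-max = (M , proj₁ M-max , refl) , bound
    where
    bound : ∀ S → Independent G S → ∣ S ∣ ≤ ∣ M ∣
    bound S S-ind with extend S S-ind
    ... | M′ , M′-max , S≤M′ = ≤-trans S≤M′ (≤-reflexive (wc M′ M M′-max M-max))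

  wellCovered-count : WellCovered G → ∀ {M M′} → MaximalIndependentᵇ G M → MaximalIndependentᵇ G M′ →
                      count M ≡ count M′
  wellCovered-count wc {M} {M′} M-max M′-max = begin
    count M            ≡⟨ ∣tabulate∣≡count M ⟨
    ∣ tabulate M ∣     ≡⟨ wc _ _ (maximalIndependent-tabulate M-max) (maximalIndependent-tabulate M′-max) ⟩
    ∣ tabulate M′ ∣    ≡⟨ ∣tabulate∣≡count M′ ⟩
    count M′           ∎
    where open ≡-Reasoning

-- Direct products

-- G ×ᵍ H is a direct product of G and H, and also, with the factors exchanged, of H and G; this
-- lets the main argument assume that the triangle-free factor comes first.
record IsDirectProduct (P Q X : Graph) : Set where
  field
    proj      : Fin (n X) → Fin (n P) × Fin (n Q)
    pair      : Fin (n P) → Fin (n Q) → Fin (n X)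
    adj-proj  : ∀ {x y} → Adj X x y →
                Adj P (proj₁ (proj x)) (proj₁ (proj y)) × Adj Q (proj₂ (proj x)) (proj₂ (proj y))
    adj-pair  : ∀ {x p q} → Adj P (proj₁ (proj x)) p → Adj Q (proj₂ (proj x)) q → Adj X x (pair p q)
    proj-pair : ∀ p q → proj (pair p q) ≡ (p , q)
    sum-proj  : ∀ (F : Fin (n P) → Fin (n Q) → ℕ) →
                sum (uncurry F ∘ proj) ≡ ∑[ p < n P ] ∑[ q < n Q ] F p q
    order     : n X ≡ n P * n Q

×ᵍ-isDirectProduct : ∀ G H → IsDirectProduct G H (G ×ᵍ H)
×ᵍ-isDirectProduct G H = record
  { proj      = remQuot (n H)
  ; pair      = combine
  ; adj-proj  = λ xy → xy
  ; adj-pair  = λ {x} {p} {q} a b → subst (λ (p′ , q′) → Adj G _ p′ × Adj H _ q′) (sym (remQuot-combine p q)) (a , b)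
  ; proj-pair = remQuot-combine
  ; sum-proj  = sum-remQuot (n G) (n H)
  ; order     = refl
  }

×ᵍ-isDirectProduct-swap : ∀ G H → IsDirectProduct H G (G ×ᵍ H)
×ᵍ-isDirectProduct-swap G H = record
  { proj      = swap ∘ remQuot (n H)
  ; pair      = flip combine
  ; adj-proj  = swap
  ; adj-pair  = λ {x} {p} {q} a b → subst (λ (q′ , p′) → Adj G _ q′ × Adj H _ p′) (sym (remQuot-combine q p)) (b , a)
  ; proj-pair = λ p q → cong swap (remQuot-combine q p)
  ; sum-proj  = λ F → trans (sum-remQuot (n G) (n H) (flip F)) (∑-comm (flip F))
  ; order     = *-comm (n G) (n H)
  }

module DirectProduct {P Q X : Graph} (X≅P×Q : IsDirectProduct P Q X) where

  open IsDirectProduct X≅P×Q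

  private
    layer : (Fin (n P) → Bool) → (Fin (n P) → Bool) → (Fin (n Q) → Bool) → Fin (n P) → Fin (n Q) → Bool
    layer K R A p q = K p ∨ (R p ∧ A q)

  layered : (Fin (n P) → Bool) → (Fin (n P) → Bool) → (Fin (n Q) → Bool) → Fin (n X) → Bool
  layered K R A = uncurry (layer K R A) ∘ proj

  noIsolatedVertices : NoIsolatedVertices P → NoIsolatedVertices Q → NoIsolatedVertices X
  noIsolatedVertices noIsoP noIsoQ x =
    pair _ _ , adj-pair (proj₂ (noIsoP (proj₁ (proj x)))) (proj₂ (noIsoQ (proj₂ (proj x))))

  layered-maximal : ∀ {K R A} →
    Independentᵇ P K →
    (∀ {p p′} → T (K p) → T (R p′) → ¬ Adj P p p′) →
    (∀ {p} → ¬ T (K p) → ¬ T (R p) → Dominated P K p) →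
    (∀ {p} → T (R p) → Dominated P R p) →
    MaximalIndependentᵇ Q A → NoIsolatedVertices Q →
    MaximalIndependentᵇ X (layered K R A)
  layered-maximal {K} {R} {A} K-ind K≁R K-dom R-dom A-max noIsoQ = record
    { independent = independent
    ; within      = λ _ → tt
    ; dominating  = λ _ → dominating
    }
    where
    module A = MaximalIndependentWithin A-max
    cases : ∀ {p q} → T (layer K R A p q) → T (K p) ⊎ (T (R p) × T (A q))
    cases x∈ with to T-∨ x∈
    ... | inj₁ p∈K = inj₁ p∈K
    ... | inj₂ pq∈ = inj₂ (to T-∧ pq∈)
    independent : Independentᵇ X (layered K R A)
    independent x∈ y∈ xy with adj-proj xy | cases x∈ | cases y∈
    ... | pp′ , _   | inj₁ p∈K        | inj₁ p′∈K        = K-ind p∈K p′∈K pp′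
    ... | pp′ , _   | inj₁ p∈K        | inj₂ (p′∈R , _)  = K≁R p∈K p′∈R pp′
    ... | pp′ , _   | inj₂ (p∈R , _)  | inj₁ p′∈K        = K≁R p′∈K p∈R (adj-sym P pp′)
    ... | _   , qq′ | inj₂ (_ , q∈A)  | inj₂ (_ , q′∈A)  = A.independent q∈A q′∈A qq′
    pair-∈ : ∀ {p q} → T (layer K R A p q) → T (layered K R A (pair p q))
    pair-∈ {p} {q} = subst (T ∘ uncurry (layer K R A)) (sym (proj-pair p q))
    dominating : ∀ {x} → ¬ T (layered K R A x) → Dominated X (layered K R A) x
    dominating {x} x∉ with T? (R (proj₁ (proj x)))
    ... | yes p∈R =
      let (p′ , p′∈R , pp′) = R-dom p∈R
          (q′ , q′∈A , qq′) = A.dominating tt (λ q∈A → x∉ (from T-∨ (inj₂ (from T-∧ (p∈R , q∈A)))))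
      in pair p′ q′ , pair-∈ (from T-∨ (inj₂ (from T-∧ (p′∈R , q′∈A)))) , adj-pair pp′ qq′
    ... | no p∉R =
      let (p′ , p′∈K , pp′) = K-dom (λ p∈K → x∉ (from T-∨ (inj₁ p∈K))) p∉R
          (q′ , qq′) = noIsoQ (proj₂ (proj x))
      in pair p′ q′ , pair-∈ (from T-∨ (inj₁ p′∈K)) , adj-pair pp′ qq′

  count-layered : ∀ K R A → (∀ {p} → T (K p) → ¬ T (R p)) →
                  count (layered K R A) ≡ count K * n Q + count R * count A
  count-layered K R A K∩R≡∅ = begin
    count (layered K R A)
      ≡⟨ sum-proj (λ p q → iverson (layer K R A p q)) ⟩
    ∑[ p < n P ] ∑[ q < n Q ] iverson (layer K R A p q)
      ≡⟨ sum-cong-≗ (λ p → count-layer (K p) (R p) K∩R≡∅) ⟩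
    ∑[ p < n P ] (iverson (K p) * n Q + iverson (R p) * count A)
      ≡⟨ ∑-distrib-+ (λ p → iverson (K p) * n Q) (λ p → iverson (R p) * count A) ⟩
    ∑[ p < n P ] (iverson (K p) * n Q) + ∑[ p < n P ] (iverson (R p) * count A)
      ≡⟨ cong₂ _+_ (*-distribʳ-sum (n Q) (iverson ∘ K)) (*-distribʳ-sum (count A) (iverson ∘ R)) ⟨
    count K * n Q + count R * count A
      ∎
    where
    open ≡-Reasoning
    count-layer : ∀ k r → (T k → ¬ T r) →
                  ∑[ q < n Q ] iverson (k ∨ (r ∧ A q)) ≡ iverson k * n Q + iverson r * count A
    count-layer true  true  k⇒¬r = ⊥-elim (k⇒¬r _ _)
    count-layer true  false _    = trans (count-full (n Q)) (sym (trans (+-identityʳ (1 * n Q)) (*-identityˡ (n Q))))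
    count-layer false true  _    = sym (+-identityʳ (count A))
    count-layer false false _    = count-empty (n Q)

  count-layered-empty : ∀ S A → count (layered S empty A) ≡ count S * n Q
  count-layered-empty S A = begin
    count (layered S empty A)               ≡⟨ count-layered S empty A (λ _ ()) ⟩
    count S * n Q + count (empty {n P}) * count A ≡⟨ cong (λ c → count S * n Q + c * count A) (count-empty (n P)) ⟩
    count S * n Q + 0                       ≡⟨ +-identityʳ _ ⟩
    count S * n Q                           ∎
    where open ≡-Reasoning

  count-layered-full : ∀ A → count (layered empty full A) ≡ n P * count A
  count-layered-full A = begin
    count (layered empty full A)                  ≡⟨ count-layered empty full A (λ ()) ⟩
    count (empty {n P}) * n Q + count (full {n P}) * count A ≡⟨ cong₂ (λ c d → c * n Q + d * count A)
                                                           (count-empty (n P)) (count-full (n P)) ⟩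
    n P * count A                                 ∎
    where open ≡-Reasoning

-- Splitting a triangle-free graph along an edge

Triangle : Graph → Set
Triangle G = ∃ λ a → ∃ λ b → ∃ λ c → Adj G a b × Adj G b c × Adj G a c

module _ (P : Graph) where

  private
    V = Fin (n P)

  Far : V → V → V → Set
  Far a b p = ¬ p ≡ a × ¬ p ≡ b × ¬ Adj P a p × ¬ Adj P b p

  far? : ∀ a b p → Dec (Far a b p)
  far? a b p = ¬? (p ≟ a) ×-dec ¬? (p ≟ b) ×-dec ¬? (adj? P a p) ×-dec ¬? (adj? P b p)

  Far-swap : ∀ {a b p} → Far a b p → Far b a p
  Far-swap (p≢a , p≢b , a≁p , b≁p) = p≢b , p≢a , b≁p , a≁p

  module Side (∄triangle : ¬ Triangle P) (K : V → Bool) (K-ind : Independentᵇ P K)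
              {a b} (ab : Adj P a b)
              (K-far : ∀ {p} → T (K p) → Far a b p)
              (K-dom : ∀ {p} → Far a b p → ¬ T (K p) → Dominated P K p) where

    PrivateNeighbour : V → Set
    PrivateNeighbour p = Adj P b p × ¬ p ≡ a × ¬ Dominated P K p

    R : V → Bool
    R p = ⌊ (p ≟ a) ⊎-dec (adj? P b p ×-dec ¬? (p ≟ a) ×-dec ¬? (dominated? P K p)) ⌋

    R-cases : ∀ {p} → T (R p) → p ≡ a ⊎ PrivateNeighbour p
    R-cases = toWitness

    a∈R : T (R a)
    a∈R = fromWitness (inj₁ refl)

    private∈R : ∀ {p} → PrivateNeighbour p → T (R p)
    private∈R = fromWitness ∘ inj₂

    K∩R≡∅ : ∀ {p} → T (K p) → ¬ T (R p)
    K∩R≡∅ p∈K p∈R with R-cases p∈R | K-far p∈K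
    ... | inj₁ p≡a          | p≢a , _ = p≢a p≡a
    ... | inj₂ (bp , _ , _) | _ , _ , _ , b≁p = b≁p bp

    S : V → Bool
    S p = K p ∨ R p

    S-cases : ∀ {p} → T (S p) → T (K p) ⊎ p ≡ a ⊎ PrivateNeighbour p
    S-cases p∈S with to T-∨ p∈S
    ... | inj₁ p∈K = inj₁ p∈K
    ... | inj₂ p∈R = inj₂ (R-cases p∈R)

    -- Apart from K, the only vertices of S are a and neighbours of b, and an edge among those
    -- would close a triangle through b.
    S-independent : Independentᵇ P S
    S-independent p∈S p′∈S = go (S-cases p∈S) (S-cases p′∈S)
      where
      go : ∀ {p p′} → T (K p) ⊎ p ≡ a ⊎ PrivateNeighbour p → T (K p′) ⊎ p′ ≡ a ⊎ PrivateNeighbour p′ →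
           ¬ Adj P p p′
      go (inj₁ p∈K)                (inj₁ p′∈K)                = K-ind p∈K p′∈K
      go (inj₁ p∈K)                (inj₂ (inj₁ refl))         = proj₁ (proj₂ (proj₂ (K-far p∈K))) ∘ adj-sym P
      go (inj₁ p∈K)                (inj₂ (inj₂ (_ , _ , ¬d))) = λ pp′ → ¬d (_ , p∈K , adj-sym P pp′)
      go (inj₂ (inj₁ refl))        (inj₁ p′∈K)                = proj₁ (proj₂ (proj₂ (K-far p′∈K)))
      go (inj₂ (inj₁ refl))        (inj₂ (inj₁ refl))         = irrefl P
      go (inj₂ (inj₁ refl))        (inj₂ (inj₂ (bp′ , _ , _))) = λ ap′ → ∄triangle (_ , _ , _ , ab , bp′ , ap′)
      go (inj₂ (inj₂ (_ , _ , ¬d))) (inj₁ p′∈K)               = λ pp′ → ¬d (_ , p′∈K , pp′)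
      go (inj₂ (inj₂ (bp , _ , _))) (inj₂ (inj₁ refl))        = λ pa → ∄triangle (_ , _ , _ , ab , bp , adj-sym P pa)
      go (inj₂ (inj₂ (bp , _ , _))) (inj₂ (inj₂ (bp′ , _ , _))) = λ pp′ → ∄triangle (_ , _ , _ , adj-sym P bp , bp′ , pp′)

    K⊆S : ∀ {p} → T (K p) → T (S p)
    K⊆S = from T-∨ ∘ inj₁

    R⊆S : ∀ {p} → T (R p) → T (S p)
    R⊆S = from T-∨ ∘ inj₂

    S-dominating : ∀ {p} → ¬ T (S p) → Dominated P S p
    S-dominating {p} p∉S = dominate (λ { refl → p∉S (R⊆S a∈R) }) (p∉S ∘ K⊆S) (p∉S ∘ R⊆S ∘ private∈R)
      where
      dominate : ¬ p ≡ a → ¬ T (K p) → ¬ PrivateNeighbour p → Dominated P S p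
      dominate p≢a p∉K ¬private with adj? P a p | p ≟ b | adj? P b p | dominated? P K p
      ... | yes ap | _        | _      | _     = a , R⊆S a∈R , adj-sym P ap
      ... | no _   | yes refl | _      | _     = a , R⊆S a∈R , adj-sym P ab
      ... | no _   | no _     | _      | yes d = Dominated-mono P K⊆S d
      ... | no _   | no _     | yes bp | no ¬d = ⊥-elim (¬private (bp , p≢a , ¬d))
      ... | no a≁p | no p≢b   | no b≁p | no ¬d = ⊥-elim (¬d (K-dom (p≢a , p≢b , a≁p , b≁p) p∉K))

    S-maximal : MaximalIndependentᵇ P S
    S-maximal = record
      { independent = S-independent
      ; within      = λ _ → tt
      ; dominating  = λ _ → S-dominating
      }

  module EdgeSplit (∄triangle : ¬ Triangle P) {u v} (uv : Adj P u v) where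

    private
      K-exists = maximalIndependentWithin-exists P (λ p → ⌊ far? u v p ⌋)
      open MaximalIndependentWithin (proj₂ K-exists)

    K : V → Bool
    K = proj₁ K-exists

    K-independent : Independentᵇ P K
    K-independent = independent

    K-far : ∀ {p} → T (K p) → Far u v p
    K-far = toWitness ∘ within

    K-dom : ∀ {p} → Far u v p → ¬ T (K p) → Dominated P K p
    K-dom = dominating ∘ fromWitness

    module Sideᵤ = Side ∄triangle K K-independent uv K-far K-dom
    module Sideᵥ = Side ∄triangle K K-independent (adj-sym P uv) (Far-swap ∘ K-far) (K-dom ∘ Far-swap)

    R₁ R₂ R : V → Bool
    R₁ = Sideᵤ.R
    R₂ = Sideᵥ.R
    R p = R₁ p ∨ R₂ p

    R₁⊆R : ∀ {p} → T (R₁ p) → T (R p)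
    R₁⊆R = from T-∨ ∘ inj₁

    R₂⊆R : ∀ {p} → T (R₂ p) → T (R p)
    R₂⊆R = from T-∨ ∘ inj₂

    R₁∩R₂≡∅ : ∀ {p} → T (R₁ p) → ¬ T (R₂ p)
    R₁∩R₂≡∅ p∈R₁ p∈R₂ with Sideᵤ.R-cases p∈R₁ | Sideᵥ.R-cases p∈R₂
    ... | inj₁ refl          | inj₁ refl          = irrefl P uv
    ... | inj₁ refl          | inj₂ (up , _ , _)  = irrefl P up
    ... | inj₂ (vp , _ , _)  | inj₁ refl          = irrefl P vp
    ... | inj₂ (vp , _ , _)  | inj₂ (up , _ , _)  = ∄triangle (_ , _ , _ , uv , vp , up)

    K∩R≡∅ : ∀ {p} → T (K p) → ¬ T (R p)
    K∩R≡∅ p∈K p∈R with to T-∨ p∈R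
    ... | inj₁ p∈R₁ = Sideᵤ.K∩R≡∅ p∈K p∈R₁
    ... | inj₂ p∈R₂ = Sideᵥ.K∩R≡∅ p∈K p∈R₂

    K≁R : ∀ {p p′} → T (K p) → T (R p′) → ¬ Adj P p p′
    K≁R p∈K p′∈R with to T-∨ p′∈R
    ... | inj₁ p′∈R₁ = Sideᵤ.S-independent (Sideᵤ.K⊆S p∈K) (Sideᵤ.R⊆S p′∈R₁)
    ... | inj₂ p′∈R₂ = Sideᵥ.S-independent (Sideᵥ.K⊆S p∈K) (Sideᵥ.R⊆S p′∈R₂)

    K-dominates : ∀ {p} → ¬ T (K p) → ¬ T (R p) → Dominated P K p
    K-dominates {p} p∉K p∉R =
      dominate (λ { refl → p∉R (R₁⊆R Sideᵤ.a∈R) }) (λ { refl → p∉R (R₂⊆R Sideᵥ.a∈R) })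
               (p∉R ∘ R₁⊆R ∘ Sideᵤ.private∈R) (p∉R ∘ R₂⊆R ∘ Sideᵥ.private∈R)
      where
      dominate : ¬ p ≡ u → ¬ p ≡ v → ¬ Sideᵤ.PrivateNeighbour p → ¬ Sideᵥ.PrivateNeighbour p →
                 Dominated P K p
      dominate p≢u p≢v ¬privateᵤ ¬privateᵥ with dominated? P K p | adj? P u p | adj? P v p
      ... | yes d  | _      | _      = d
      ... | no ¬d  | yes up | _      = ⊥-elim (¬privateᵥ (up , p≢v , ¬d))
      ... | no ¬d  | _      | yes vp = ⊥-elim (¬privateᵤ (vp , p≢u , ¬d))
      ... | no ¬d  | no u≁p | no v≁p = ⊥-elim (¬d (K-dom (p≢u , p≢v , u≁p , v≁p) p∉K))

    R-dominated : ∀ {p} → T (R p) → Dominated P R p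
    R-dominated p∈R with to T-∨ p∈R
    ... | inj₁ p∈R₁ = v , R₂⊆R Sideᵥ.a∈R ,
                      [ (λ { refl → uv }) , adj-sym P ∘ proj₁ ]′ (Sideᵤ.R-cases p∈R₁)
    ... | inj₂ p∈R₂ = u , R₁⊆R Sideᵤ.a∈R ,
                      [ (λ { refl → adj-sym P uv }) , adj-sym P ∘ proj₁ ]′ (Sideᵥ.R-cases p∈R₂)

-- Well-covered products with a triangle-free factor

balanced⇒≡2* : ∀ k r₁ r₂ N α → 0 < r₁ + r₂ →
               (k + r₁) * N ≡ k * N + (r₁ + r₂) * α → (k + r₂) * N ≡ k * N + (r₁ + r₂) * α →
               N ≡ 2 * α
balanced⇒≡2* k r₁ r₂ N α r>0 eq₁ eq₂ = *-cancelˡ-≡ N (2 * α) (r₁ + r₂) {{>-nonZero r>0}} (begin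
  (r₁ + r₂) * N          ≡⟨ *-distribʳ-+ N r₁ r₂ ⟩
  r₁ * N + r₂ * N        ≡⟨ cong₂ _+_ (cancel r₁ eq₁) (cancel r₂ eq₂) ⟩
  r * α + r * α          ≡⟨ double r α ⟩
  r * (2 * α)            ∎)
  where
  open ≡-Reasoning
  r = r₁ + r₂
  cancel : ∀ rᵢ → (k + rᵢ) * N ≡ k * N + r * α → rᵢ * N ≡ r * α
  cancel rᵢ eq = +-cancelˡ-≡ (k * N) _ _ (trans (sym (*-distribʳ-+ N k rᵢ)) eq)
  double : ∀ x y → x * y + x * y ≡ x * (2 * y)
  double = solve-∀

module _ {P Q X : Graph} (X≅P×Q : IsDirectProduct P Q X) (∄triangle : ¬ Triangle P)
         (noIsoQ : NoIsolatedVertices Q) (wc : WellCovered X) where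

  open IsDirectProduct X≅P×Q using (order)
  open DirectProduct X≅P×Q

  maximalIndependent-halves : ∀ {A} → MaximalIndependentᵇ Q A → ∀ {u v} → Adj P u v → n Q ≡ 2 * count A
  maximalIndependent-halves {A} A-max uv =
    balanced⇒≡2* (count K) (count R₁) (count R₂) (n Q) (count A)
      (≤-trans (T⇒0<count R₁ Sideᵤ.a∈R) (m≤m+n _ _))
      (side-balanced Sideᵤ.K∩R≡∅ Sideᵤ.S-maximal)
      (side-balanced Sideᵥ.K∩R≡∅ Sideᵥ.S-maximal)
    where
    open EdgeSplit P ∄triangle uv
    open ≡-Reasoning
    M-maximal : MaximalIndependentᵇ X (layered K R A)
    M-maximal = layered-maximal K-independent K≁R K-dominates R-dominated A-max noIsoQ
    side-balanced : ∀ {Rᵢ} → (∀ {p} → T (K p) → ¬ T (Rᵢ p)) → MaximalIndependentᵇ P (λ p → K p ∨ Rᵢ p) →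
                    (count K + count Rᵢ) * n Q ≡ count K * n Q + (count R₁ + count R₂) * count A
    side-balanced {Rᵢ} K∩Rᵢ≡∅ S-maximal = begin
      (count K + count Rᵢ) * n Q
        ≡⟨ cong (_* n Q) (count-∨ K Rᵢ K∩Rᵢ≡∅) ⟨
      count S * n Q
        ≡⟨ count-layered-empty S A ⟨
      count (layered S empty A)
        ≡⟨ wellCovered-count X wc S×Q-maximal M-maximal ⟩
      count (layered K R A)
        ≡⟨ count-layered K R A K∩R≡∅ ⟩
      count K * n Q + count R * count A
        ≡⟨ cong (λ c → count K * n Q + c * count A) (count-∨ R₁ R₂ R₁∩R₂≡∅) ⟩
      count K * n Q + (count R₁ + count R₂) * count A
        ∎
      where
      S : Fin (n P) → Bool
      S p = K p ∨ Rᵢ p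
      open MaximalIndependentWithin S-maximal
      S×Q-maximal : MaximalIndependentᵇ X (layered S empty A)
      S×Q-maximal = layered-maximal independent (λ _ ()) (λ p∉S _ → dominating tt p∉S) (λ ()) A-max noIsoQ

  triangleFree⇒veryWellCovered : NoIsolatedVertices P → Fin (n P) → VeryWellCovered X
  triangleFree⇒veryWellCovered noIsoP u =
    wc , noIsolatedVertices noIsoP noIsoQ ,
    ∣ tabulate M ∣ , wellCovered⇒independenceNumber X wc (maximalIndependent-tabulate X M-maximal) , half
    where
    A-exists = maximalIndependentWithin-exists Q full
    A = proj₁ A-exists
    A-maximal = proj₂ A-exists
    M = layered empty full A
    M-maximal : MaximalIndependentᵇ X M
    M-maximal = layered-maximal (λ ()) (λ ()) (λ _ p∉P → ⊥-elim (p∉P tt))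
                  (λ {p} _ → let (p′ , pp′) = noIsoP p in p′ , tt , pp′) A-maximal noIsoQ
    half : 2 * ∣ tabulate M ∣ ≡ n X
    half = begin
      2 * ∣ tabulate M ∣  ≡⟨ cong (2 *_) (trans (∣tabulate∣≡count M) (count-layered-full A)) ⟩
      2 * (n P * count A) ≡⟨ *-assoc 2 (n P) (count A) ⟨
      2 * n P * count A   ≡⟨ cong (_* count A) (*-comm 2 (n P)) ⟩
      n P * 2 * count A   ≡⟨ *-assoc (n P) 2 (count A) ⟩
      n P * (2 * count A) ≡⟨ cong (n P *_) (maximalIndependent-halves A-maximal (proj₂ (noIsoP u))) ⟨
      n P * n Q           ≡⟨ order ⟨
      n X                 ∎
      where open ≡-Reasoning

triangle? : ∀ G → Dec (Triangle G)
triangle? G = any? λ a → any? λ b → any? λ c → adj? G a b ×-dec adj? G b c ×-dec adj? G a c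

triangle⇒girth3 : ∀ {G} → Triangle G → HasGirth G 3
triangle⇒girth3 {G} (a , b , c , ab , bc , ac) = (s≤s (s≤s z≤n) , f , f-injective , f-path , adj-sym G ac) , shortest
  where
  f : Fin 3 → Fin (n G)
  f zero             = a
  f (suc zero)       = b
  f (suc (suc zero)) = c
  adj⇒≢ : ∀ {x y} → Adj G x y → ¬ x ≡ y
  adj⇒≢ xy refl = irrefl G xy
  f-injective : ∀ {i j} → f i ≡ f j → i ≡ j
  f-injective {zero}             {zero}             _ = refl
  f-injective {zero}             {suc zero}         e = ⊥-elim (adj⇒≢ ab e)
  f-injective {zero}             {suc (suc zero)}   e = ⊥-elim (adj⇒≢ ac e)
  f-injective {suc zero}         {zero}             e = ⊥-elim (adj⇒≢ ab (sym e))
  f-injective {suc zero}         {suc zero}         _ = refl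
  f-injective {suc zero}         {suc (suc zero)}   e = ⊥-elim (adj⇒≢ bc e)
  f-injective {suc (suc zero)}   {zero}             e = ⊥-elim (adj⇒≢ ac (sym e))
  f-injective {suc (suc zero)}   {suc zero}         e = ⊥-elim (adj⇒≢ bc (sym e))
  f-injective {suc (suc zero)}   {suc (suc zero)}   _ = refl
  f-path : ∀ (i : Fin 2) → Adj G (f (inject₁ i)) (f (suc i))
  f-path zero       = ab
  f-path (suc zero) = bc
  shortest : ∀ k → Cycle G k → 3 ≤ k
  shortest (suc m) (2≤m , _) = s≤s 2≤m

two-distinct : ∀ {m} → 2 ≤ m → ∃ λ (i : Fin m) → ∃ λ j → ¬ i ≡ j
two-distinct (s≤s (s≤s _)) = zero , suc zero , λ ()

walk⇒neighbour : ∀ {G u w} → Walk G u w → ¬ u ≡ w → ∃ (Adj G u)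
walk⇒neighbour here         u≢u = ⊥-elim (u≢u refl)
walk⇒neighbour (step uv _)  _   = _ , uv

connected⇒noIsolatedVertices : ∀ G → Nontrivial G → Connected G → NoIsolatedVertices G
connected⇒noIsolatedVertices G nontrivial connected u with two-distinct nontrivial
... | i , j , i≢j with u ≟ i
...   | yes refl = walk⇒neighbour (connected u j) i≢j
...   | no  u≢i  = walk⇒neighbour (connected u i) u≢i

corollary5p3 : (G H : Graph) → Nontrivial G → Nontrivial H → Connected G → Connected H →
    WellCovered (G ×ᵍ H) → ¬ VeryWellCovered (G ×ᵍ H) → HasGirth G 3 × HasGirth H 3
corollary5p3 G H ntG ntH cG cH wc ¬vwc =
  girth3 G (λ ∄△G → triangleFree⇒veryWellCovered (×ᵍ-isDirectProduct G H) ∄△G noIsoH wc noIsoG (vertex G ntG)) ,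
  girth3 H (λ ∄△H → triangleFree⇒veryWellCovered (×ᵍ-isDirectProduct-swap G H) ∄△H noIsoG wc noIsoH (vertex H ntH))
  where
  noIsoG = connected⇒noIsolatedVertices G ntG cG
  noIsoH = connected⇒noIsolatedVertices H ntH cH
  vertex : ∀ F → Nontrivial F → Fin (n F)
  vertex F = proj₁ ∘ two-distinct
  girth3 : ∀ F → (¬ Triangle F → VeryWellCovered (G ×ᵍ H)) → HasGirth F 3
  girth3 F triangleFree⇒vwc with triangle? F
  ... | yes △  = triangle⇒girth3 △
  ... | no  ∄△ = ⊥-elim (¬vwc (triangleFree⇒vwc ∄△))
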